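{- Let $p,q_1,\dots,q_k$ be primes with $p<q_1<\cdots<q_k$, and let $a\in\mathbb{N}$. If $p^{a-2}>q_1\cdots q_{k-1}q_k^2$, then $p^a$ reduces to $p^bq_1\cdots q_k$, where $$b=\left\lfloor\frac12\left(a-\frac{\log(q_1\cdots q_{k-1})}{\log p}\right)\right\rfloor$$ (the empty product being interpreted as $1$).
   Context: For $n\in\mathbb{N}$, $\mathcal{D}(n)$ is the set of positive divisors of $n$; $\lambda(n)$ is the least prime factor of $n$ if $n\ge2$, and $\lambda(1)=1$. For $m,n\in\mathbb{N}$, a function $f:\mathcal{D}(n)\to\mathcal{D}(m)$ is reducing if for all $d,d'\in\mathcal{D}(n)$: (a) $f(d)\le d$; (b) $\frac{m/f(d)}{n/d}\le\min\left\{1,\frac{\lambda(m/f(d))}{\lambda(n/d)}\right\}$; (c) if $f(d)=2^if(d')$ for some $i\in\mathbb{Z}$, then $d=2^jd'$ for some $j\in\mathbb{Z}$. We say $n$ reduces to $m$ if a reducing function $\mathcal{D}(n)\to\mathcal{D}(m)$ exists. -}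

module Defs where

open import Data.Nat using (ℕ; zero; suc; _+_; _*_; _^_; _≤_; _<_)
open import Data.Nat.Divisibility using (_∣_)
open import Data.Nat.Primality using (Prime)
open import Data.Fin using (Fin; inject₁; fromℕ)
open import Data.List using (tabulate)
open import Data.Nat.ListAction using (product)
open import Data.Product using (Σ; ∃; _×_; _,_; proj₁; proj₂)
open import Data.Sum using (_⊎_)
open import Relation.Binary.PropositionalEquality using (_≡_)

-- 𝒟(n): positive divisors of n (for n ≥ 1 every divisor is positive).
𝒟 : ℕ → Set
𝒟 n = Σ ℕ (λ d → d ∣ n)

cofactor : ∀ {n} → 𝒟 n → ℕ
cofactor (_ , d∣n) = _∣_.quotient d∣n

LPF : ℕ → ℕ → Set
LPF n ℓ = (n ≡ 1 × ℓ ≡ 1)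
        ⊎ (Prime ℓ × ℓ ∣ n × (∀ r → Prime r → r ∣ n → ℓ ≤ r))

-- x = 2^i y for some integer i
Pow2Related : ℕ → ℕ → Set
Pow2Related x y = ∃ λ i → ∃ λ j → x * 2 ^ i ≡ y * 2 ^ j

-- reducing function 𝒟(n) → 𝒟(m)
-- (b) with A = m/f(d), B = n/d:  A/B ≤ min{1, λ(A)/λ(B)}
--     ⇔ A ≤ B  and  A·λ(B) ≤ λ(A)·B   (all quantities positive)
Reducing : (n m : ℕ) → (𝒟 n → 𝒟 m) → Set
Reducing n m f =
  (∀ d → proj₁ (f d) ≤ proj₁ d)
  × (∀ d → ∀ ℓA ℓB → LPF (cofactor (f d)) ℓA → LPF (cofactor d) ℓB →
       cofactor (f d) ≤ cofactor d × cofactor (f d) * ℓB ≤ ℓA * cofactor d)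
  × (∀ d d' → Pow2Related (proj₁ (f d)) (proj₁ (f d')) →
       Pow2Related (proj₁ d) (proj₁ d'))

Reduces : ℕ → ℕ → Set
Reduces n m = Σ (𝒟 n → 𝒟 m) (Reducing n m)

-- product q_1 ⋯ q_{k-1} for q : Fin (suc k) → ℕ (indices 0..k, last one is q_k)
initProd : ∀ {k} → (Fin (suc k) → ℕ) → ℕ
initProd {k} q = product (tabulate {n = k} (λ i → q (inject₁ i)))

lastQ : ∀ {k} → (Fin (suc k) → ℕ) → ℕ
lastQ {k} q = q (fromℕ k)

module Submission where

-- Write m = p^b Q qₖ = q₀ N with N = p^b q₁⋯qₖ.  The hypotheses force qₖ < p^b, so
-- multiplying p^b by the qⱼ (j ≥ 1) one at a time keeps the divisors of N p-dense: every
-- x < pN satisfies d ≤ x < pd for some divisor d of N.  The divisor p^i of p^a with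
-- i + b < a is sent to such a d for x = p^i, with cofactor q₀N/d; the remaining p^i are
-- sent to m/p^(a-i).  The bounds on b make each cofactor at most p^(a-i), and as every
-- prime factor of m is at least p this gives condition (b).  The image determines i (the
-- two kinds are told apart by whether q₀ divides the cofactor), and images are odd unless
-- p = 2, which gives condition (c).

open import Defs
open import Data.Nat using (ℕ; suc; _+_; _*_; _^_; _≤_; _<_)
open import Data.Nat.Primality using (Prime)
open import Data.Fin using (Fin; zero)
import Data.Fin as F

open import Data.Empty using (⊥-elim)
open import Data.Fin using (inject₁; fromℕ)
import Data.Fin.Properties as Fin
open import Data.List using ([]; _∷_; tabulate)
open import Data.List.Membership.Propositional.Properties using (∈-tabulate⁻)
open import Data.List.Relation.Unary.All as All using (All; []; _∷_)
open import Data.List.Relation.Unary.All.Properties using (tabulate⁺)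
open import Data.Nat using (z≤n; s≤s; s≤s⁻¹; _∸_; NonZero; >-nonZero; nonTrivial⇒n>1; _≟_; _<?_)
open import Data.Nat.Coprimality using (Coprime; coprime-divisor)
open import Data.Nat.Divisibility
open import Data.Nat.DivMod
open import Data.Nat.ListAction using (product)
open import Data.Nat.Primality using (prime⇒nonZero; prime⇒nonTrivial; prime⇒irreducible; euclidsLemma; productOfPrimes≢0; prime[2])
open import Data.Nat.Primality.Factorisation using (factorisationHasAllPrimeFactors)
open import Data.Nat.Properties
open import Data.Nat.Tactic.RingSolver using (solve-∀)
open import Data.Product using (∃-syntax; _×_; _,_; proj₁; proj₂)
open import Data.Sum using (_⊎_; inj₁; inj₂)
open import Function using (_∘_)
open import Relation.Binary using (tri<; tri≈; tri>)
open import Relation.Binary.PropositionalEquality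
open import Relation.Nullary using (¬_; yes; no)

private
  variable
    ℓ p n d r x y A B ℓA ℓB : ℕ

prime>1 : Prime p → 1 < p
prime>1 {p} p-prime = nonTrivial⇒n>1 p {{prime⇒nonTrivial p-prime}}

prime≢1 : Prime p → p ≢ 1
prime≢1 p-prime refl = <-irrefl refl (prime>1 p-prime)

prime∣prime⇒≡ : Prime ℓ → Prime p → ℓ ∣ p → ℓ ≡ p
prime∣prime⇒≡ ℓ-prime p-prime ℓ∣p with prime⇒irreducible p-prime ℓ∣p
... | inj₁ ℓ≡1 = ⊥-elim (prime≢1 ℓ-prime ℓ≡1)
... | inj₂ ℓ≡p = ℓ≡p

prime∣prime^⇒≡ : Prime ℓ → Prime p → ∀ n → ℓ ∣ p ^ n → ℓ ≡ p
prime∣prime^⇒≡ ℓ-prime p-prime 0 ℓ∣1 = ⊥-elim (prime≢1 ℓ-prime (∣1⇒≡1 ℓ∣1))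
prime∣prime^⇒≡ {p = p} ℓ-prime p-prime (suc n) ℓ∣p^[1+n] with euclidsLemma p (p ^ n) ℓ-prime ℓ∣p^[1+n]
... | inj₁ ℓ∣p   = prime∣prime⇒≡ ℓ-prime p-prime ℓ∣p
... | inj₂ ℓ∣p^n = prime∣prime^⇒≡ ℓ-prime p-prime n ℓ∣p^n

∣prime^⇒≡prime^ : Prime p → ∀ n → d ∣ p ^ n → ∃[ i ] i ≤ n × d ≡ p ^ i
∣prime^⇒≡prime^ p-prime 0 d∣1 = 0 , z≤n , ∣1⇒≡1 d∣1
∣prime^⇒≡prime^ {p} {d = d} p-prime (suc n) d∣p^[1+n] with p ∣? d
... | yes (divides c refl) =
  let instance p≢0 : NonZero p
               p≢0 = prime⇒nonZero p-prime
      i , i≤n , c≡p^i = ∣prime^⇒≡prime^ p-prime n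
                          (*-cancelʳ-∣ {c} p (subst (c * p ∣_) (*-comm p (p ^ n)) d∣p^[1+n]))
  in suc i , s≤s i≤n , trans (cong (_* p) c≡p^i) (*-comm (p ^ i) p)
... | no p∤d =
  let i , i≤n , d≡p^i = ∣prime^⇒≡prime^ p-prime n (coprime-divisor d⊥p d∣p^[1+n])
  in i , m≤n⇒m≤1+n i≤n , d≡p^i
  where
  d⊥p : Coprime d p
  d⊥p (e∣d , e∣p) with prime⇒irreducible p-prime e∣p
  ... | inj₁ e≡1 = e≡1
  ... | inj₂ refl = ⊥-elim (p∤d e∣d)

Pow2Related-2^ : ∀ i j → Pow2Related (2 ^ i) (2 ^ j)
Pow2Related-2^ i j = j , i , *-comm (2 ^ i) (2 ^ j)

private
  *2^[1+u] : ∀ x u → x * 2 ^ suc u ≡ x * 2 ^ u * 2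
  *2^[1+u] x u = trans (cong (x *_) (*-comm 2 (2 ^ u))) (sym (*-assoc x (2 ^ u) 2))

  ∣*2^[1+u] : ∀ x u → 2 ∣ x * 2 ^ suc u
  ∣*2^[1+u] x u = divides (x * 2 ^ u) (*2^[1+u] x u)

  odd*2^-cancel : ∀ u v → ¬ 2 ∣ x → ¬ 2 ∣ y → x * 2 ^ u ≡ y * 2 ^ v → x ≡ y
  odd*2^-cancel {x} {y} 0 0 _ _ eq = *-cancelʳ-≡ x y 1 eq
  odd*2^-cancel {x} {y} 0 (suc v) 2∤x _ eq =
    ⊥-elim (2∤x (subst (2 ∣_) (trans (sym eq) (*-identityʳ x)) (∣*2^[1+u] y v)))
  odd*2^-cancel {x} {y} (suc u) 0 _ 2∤y eq =
    ⊥-elim (2∤y (subst (2 ∣_) (trans eq (*-identityʳ y)) (∣*2^[1+u] x u)))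
  odd*2^-cancel {x} {y} (suc u) (suc v) 2∤x 2∤y eq = odd*2^-cancel u v 2∤x 2∤y
    (*-cancelʳ-≡ _ _ 2 (trans (sym (*2^[1+u] x u)) (trans eq (*2^[1+u] y v))))

odd-Pow2Related⇒≡ : ¬ 2 ∣ x → ¬ 2 ∣ y → Pow2Related x y → x ≡ y
odd-Pow2Related⇒≡ 2∤x 2∤y (u , v , eq) = odd*2^-cancel u v 2∤x 2∤y eq

^-cancelʳ-< : ∀ {m n} p .{{_ : NonZero p}} → p ^ m < p ^ n → m < n
^-cancelʳ-< {m} {n} p p^m<p^n with m <? n
... | yes m<n = m<n
... | no m≮n = ⊥-elim (<⇒≱ p^m<p^n (^-monoʳ-≤ p (≮⇒≥ m≮n)))

^-injectiveʳ : ∀ {m n} → 1 < p → p ^ m ≡ p ^ n → m ≡ n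
^-injectiveʳ {p} {m} {n} 1<p eq with <-cmp m n
... | tri≈ _ m≡n _ = m≡n
... | tri< m<n _ _ = ⊥-elim (<-irrefl eq (^-monoʳ-< p 1<p m<n))
... | tri> _ _ n<m = ⊥-elim (<-irrefl (sym eq) (^-monoʳ-< p 1<p n<m))

m*m<n*n⇒m<n : ∀ {m n} → m * m < n * n → m < n
m*m<n*n⇒m<n {m} {n} m²<n² with m <? n
... | yes m<n = m<n
... | no m≮n = ⊥-elim (<⇒≱ m²<n² (*-mono-≤ (≮⇒≥ m≮n) (≮⇒≥ m≮n)))

product-tabulate-inject₁ : ∀ n (g : Fin (suc n) → ℕ) →
  product (tabulate (g ∘ inject₁)) * g (fromℕ n) ≡ product (tabulate g)
product-tabulate-inject₁ 0 g = *-comm 1 (g zero)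
product-tabulate-inject₁ (suc n) g =
  trans (*-assoc (g zero) _ _) (cong (g zero *_) (product-tabulate-inject₁ n (g ∘ F.suc)))

Dense : ℕ → ℕ → Set
Dense p N = ∀ x → 1 ≤ x → x < p * N → ∃[ d ] d ∣ N × d ≤ x × x < p * d

Dense-p* : ∀ {N} → Dense p N → Dense p (p * N)
Dense-p* {p} {N} dense x 1≤x x<p²N with x <? p * N
... | yes x<pN = let d , d∣N , rest = dense x 1≤x x<pN in d , ∣n⇒∣m*n p d∣N , rest
... | no  x≮pN = p * N , ∣-refl , ≮⇒≥ x≮pN , x<p²N

Dense-p^ : ∀ p n → Dense p (p ^ n)
Dense-p^ p 0 x 1≤x x<p*1 = 1 , ∣-refl , 1≤x , x<p*1
Dense-p^ p (suc n) = Dense-p* {p} (Dense-p^ p n)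

Dense-*ʳ : ∀ {N} .{{_ : NonZero p}} → Dense p N → 1 ≤ r → r ≤ N → Dense p (N * r)
Dense-*ʳ {p} {r} {N} dense 1≤r r≤N x 1≤x x<pNr with x <? p * N
... | yes x<pN = let c , c∣N , rest = dense x 1≤x x<pN in c , ∣-trans c∣N (m∣m*n r) , rest
... | no  x≮pN = scale (dense (x / r) 1≤x/r x/r<pN)
  where
  instance
    r≢0 : NonZero r
    r≢0 = >-nonZero 1≤r
  1≤x/r : 1 ≤ x / r
  1≤x/r = m≥n⇒m/n>0 (≤-trans r≤N (≤-trans (m≤n*m N p) (≮⇒≥ x≮pN)))
  x/r<pN : x / r < p * N
  x/r<pN = m<n*o⇒m/o<n (subst (x <_) (sym (*-assoc p N r)) x<pNr)
  scale : ∃[ c ] c ∣ N × c ≤ x / r × x / r < p * c → ∃[ c ] c ∣ N * r × c ≤ x × x < p * c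
  scale (c , c∣N , c≤x/r , x/r<pc) =
    c * r , *-monoˡ-∣ r c∣N , ≤-trans (*-monoˡ-≤ r c≤x/r) (m/n*n≤m x r) , x<pcr
    where
    open ≤-Reasoning
    x<pcr : x < p * (c * r)
    x<pcr = begin-strict
      x                   ≡⟨ m≡m%n+[m/n]*n x r ⟩
      x % r + x / r * r   <⟨ +-monoˡ-< (x / r * r) (m%n<n x r) ⟩
      suc (x / r) * r     ≤⟨ *-monoˡ-≤ r x/r<pc ⟩
      p * c * r           ≡⟨ *-assoc p c r ⟩
      p * (c * r)         ∎

Dense-*-product : ∀ {N rs} .{{_ : NonZero p}} →
  Dense p N → All (λ r → 1 ≤ r × r ≤ N) rs → Dense p (N * product rs)
Dense-*-product {p} {N} {[]} dense [] = subst (Dense p) (sym (*-identityʳ N)) dense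
Dense-*-product {p} {N} {r ∷ rs} dense ((1≤r , r≤N) ∷ bounds) =
  subst (Dense p) (*-assoc N r (product rs))
    (Dense-*-product (Dense-*ʳ dense 1≤r r≤N) (All.map grow bounds))
  where
  instance
    r≢0 : NonZero r
    r≢0 = >-nonZero 1≤r
  grow : ∀ {s} → 1 ≤ s × s ≤ N → 1 ≤ s × s ≤ N * r
  grow (1≤s , s≤N) = 1≤s , ≤-trans s≤N (m≤m*n N r)

LPF⇒≥1 : LPF n ℓ → 1 ≤ ℓ
LPF⇒≥1 (inj₁ (_ , refl)) = ≤-refl
LPF⇒≥1 (inj₂ (ℓ-prime , _)) = <⇒≤ (prime>1 ℓ-prime)

-- λ(B) ∈ {1, p}, and p ≤ λ(A) unless A = 1, in which case λ(B) ≤ B suffices.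
LPF-cross-≤ : Prime p → (∀ ℓ → Prime ℓ → ℓ ∣ A → p ≤ ℓ) → B ∣ p ^ n → 0 < B → A ≤ B →
              LPF A ℓA → LPF B ℓB → A * ℓB ≤ ℓA * B
LPF-cross-≤ {A = A} {B} {ℓA = ℓA} _ _ _ _ A≤B lpfA (inj₁ (_ , refl)) =
  subst (_≤ ℓA * B) (sym (*-identityʳ A)) (≤-trans A≤B (m≤n*m B ℓA {{>-nonZero (LPF⇒≥1 lpfA)}}))
LPF-cross-≤ {B = B} {ℓB = ℓB} _ _ _ 0<B _ (inj₁ (refl , refl)) (inj₂ (_ , ℓB∣B , _)) =
  subst₂ _≤_ (sym (*-identityˡ ℓB)) (sym (*-identityˡ B)) (∣⇒≤ {{>-nonZero 0<B}} ℓB∣B)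
LPF-cross-≤ {p} {A} {B} {n} {ℓA} {ℓB} p-prime rough B∣p^n _ A≤B
    (inj₂ (ℓA-prime , ℓA∣A , _)) (inj₂ (ℓB-prime , ℓB∣B , _)) =
  subst (A * ℓB ≤_) (*-comm B ℓA) (*-mono-≤ A≤B ℓB≤ℓA)
  where
  ℓB≤ℓA : ℓB ≤ ℓA
  ℓB≤ℓA = subst (_≤ ℓA) (sym (prime∣prime^⇒≡ ℓB-prime p-prime n (∣-trans ℓB∣B B∣p^n)))
                (rough ℓA ℓA-prime ℓA∣A)

module Reduction
  (p k a b : ℕ) (q : Fin (suc k) → ℕ)
  (p-prime : Prime p) (q-prime : ∀ i → Prime (q i))
  (p<q₀ : p < q zero) (q-increasing : ∀ i j → i F.< j → q i < q j)
  (Qqₖ²p²<p^a : initProd q * lastQ q * lastQ q * p ^ 2 < p ^ a)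
  (p^2bQ≤p^a : p ^ (2 * b) * initProd q ≤ p ^ a)
  (p^a<p^[2b+2]Q : p ^ a < p ^ (2 * b + 2) * initProd q)
  where

  instance
    p≢0 : NonZero p
    p≢0 = prime⇒nonZero p-prime

  Q qₖ q₀ N m : ℕ
  Q = initProd q
  qₖ = lastQ q
  q₀ = q zero
  N = p ^ b * product (tabulate (q ∘ F.suc))
  m = p ^ b * Q * qₖ

  p<q : ∀ j → p < q j
  p<q zero = p<q₀
  p<q (F.suc j) = <-trans p<q₀ (q-increasing zero (F.suc j) (s≤s z≤n))

  q≤qₖ : ∀ j → q j ≤ qₖ
  q≤qₖ j with j F.≟ fromℕ k
  ... | yes refl = ≤-refl
  ... | no j≢k = <⇒≤ (q-increasing j (fromℕ k) (Fin.≤∧≢⇒< (Fin.≤fromℕ j) j≢k))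

  m≡p^b*∏q : m ≡ p ^ b * product (tabulate q)
  m≡p^b*∏q = trans (*-assoc (p ^ b) Q qₖ) (cong (p ^ b *_) (product-tabulate-inject₁ k q))

  m≡q₀*N : m ≡ q₀ * N
  m≡q₀*N = trans m≡p^b*∏q (x*[y*z]≡y*[x*z] (p ^ b) q₀ (product (tabulate (q ∘ F.suc))))
    where
    x*[y*z]≡y*[x*z] : ∀ x y z → x * (y * z) ≡ y * (x * z)
    x*[y*z]≡y*[x*z] = solve-∀

  instance
    m≢0 : NonZero m
    m≢0 = subst NonZero (sym m≡p^b*∏q)
            (m*n≢0 (p ^ b) _ {{m^n≢0 p b}} {{productOfPrimes≢0 (tabulate⁺ q-prime)}})

  m-rough : ∀ ℓ → Prime ℓ → ℓ ∣ m → p ≤ ℓ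
  m-rough ℓ ℓ-prime ℓ∣m with euclidsLemma (p ^ b) _ ℓ-prime (subst (ℓ ∣_) m≡p^b*∏q ℓ∣m)
  ... | inj₁ ℓ∣p^b = ≤-reflexive (sym (prime∣prime^⇒≡ ℓ-prime p-prime b ℓ∣p^b))
  ... | inj₂ ℓ∣∏q with ∈-tabulate⁻ {f = q} (factorisationHasAllPrimeFactors ℓ-prime ℓ∣∏q (tabulate⁺ q-prime))
  ...   | j , refl = <⇒≤ (p<q j)

  p^[2b]≡ : p ^ (2 * b) ≡ p ^ b * p ^ b
  p^[2b]≡ = trans (^-distribˡ-+-* p b (b + 0)) (cong (λ e → p ^ b * p ^ e) (+-identityʳ b))

  p^[2b+2]≡ : p ^ (2 * b + 2) ≡ p ^ b * p ^ b * p ^ 2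
  p^[2b+2]≡ = trans (^-distribˡ-+-* p (2 * b) 2) (cong (_* p ^ 2) p^[2b]≡)

  qₖ<p^b : qₖ < p ^ b
  qₖ<p^b = m*m<n*n⇒m<n (*-cancelʳ-< (Q * p ^ 2) _ _ (begin-strict
      qₖ * qₖ * (Q * p ^ 2)          ≡⟨ rearrange qₖ Q (p ^ 2) ⟩
      Q * qₖ * qₖ * p ^ 2            <⟨ <-trans Qqₖ²p²<p^a p^a<p^[2b+2]Q ⟩
      p ^ (2 * b + 2) * Q            ≡⟨ cong (_* Q) p^[2b+2]≡ ⟩
      p ^ b * p ^ b * p ^ 2 * Q      ≡⟨ *-assoc (p ^ b * p ^ b) (p ^ 2) Q ⟩
      p ^ b * p ^ b * (p ^ 2 * Q)    ≡⟨ cong (p ^ b * p ^ b *_) (*-comm (p ^ 2) Q) ⟩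
      p ^ b * p ^ b * (Q * p ^ 2)    ∎))
    where
    open ≤-Reasoning
    rearrange : ∀ x y z → x * x * (y * z) ≡ y * x * x * z
    rearrange = solve-∀

  m*p<p^a : m * p < p ^ a
  m*p<p^a = m*m<n*n⇒m<n (begin-strict
      m * p * (m * p)                             ≡⟨ rearrange (p ^ b) Q qₖ p ⟩
      p ^ b * p ^ b * Q * (Q * qₖ * qₖ * p ^ 2)   ≡⟨ cong (λ e → e * Q * (Q * qₖ * qₖ * p ^ 2)) p^[2b]≡ ⟨
      p ^ (2 * b) * Q * (Q * qₖ * qₖ * p ^ 2)     ≤⟨ *-monoˡ-≤ _ p^2bQ≤p^a ⟩
      p ^ a * (Q * qₖ * qₖ * p ^ 2)               <⟨ *-monoʳ-< (p ^ a) {{m^n≢0 p a}} Qqₖ²p²<p^a ⟩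
      p ^ a * p ^ a                               ∎)
    where
    open ≤-Reasoning
    rearrange : ∀ x y z w → x * y * z * w * (x * y * z * w) ≡ x * x * y * (y * z * z * (w * (w * 1)))
    rearrange = solve-∀

  p^a<p^[2+b]*N : p ^ a < p ^ (2 + b) * N
  p^a<p^[2+b]*N = *-cancelʳ-< q₀ _ _ (begin-strict
      p ^ a * q₀                     <⟨ *-monoˡ-< q₀ {{>-nonZero (≤-<-trans z≤n p<q₀)}} p^a<p^[2b+2]Q ⟩
      p ^ (2 * b + 2) * Q * q₀       ≤⟨ *-monoʳ-≤ (p ^ (2 * b + 2) * Q) (q≤qₖ zero) ⟩
      p ^ (2 * b + 2) * Q * qₖ       ≡⟨ cong (λ e → e * Q * qₖ) p^[2b+2]≡[2+b]+b ⟩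
      p ^ (2 + b) * p ^ b * Q * qₖ   ≡⟨ rearrange (p ^ (2 + b)) (p ^ b) Q qₖ ⟩
      p ^ (2 + b) * m                ≡⟨ cong (p ^ (2 + b) *_) m≡q₀*N ⟩
      p ^ (2 + b) * (q₀ * N)         ≡⟨ swap (p ^ (2 + b)) q₀ N ⟩
      p ^ (2 + b) * N * q₀           ∎)
    where
    open ≤-Reasoning
    p^[2b+2]≡[2+b]+b : p ^ (2 * b + 2) ≡ p ^ (2 + b) * p ^ b
    p^[2b+2]≡[2+b]+b = trans (cong (p ^_) (exponents b)) (^-distribˡ-+-* p (2 + b) b)
      where
      exponents : ∀ x → 2 * x + 2 ≡ (2 + x) + x
      exponents = solve-∀
    rearrange : ∀ x y z w → x * y * z * w ≡ x * (y * z * w)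
    rearrange = solve-∀
    swap : ∀ x y z → x * (y * z) ≡ x * z * y
    swap = solve-∀

  p^i<p*N : ∀ {i} → i + b < a → p ^ i < p * N
  p^i<p*N {i} i+b<a = *-cancelʳ-< (p ^ suc b) _ _ (begin-strict
      p ^ i * p ^ suc b    ≡⟨ ^-distribˡ-+-* p i (suc b) ⟨
      p ^ (i + suc b)      ≤⟨ ^-monoʳ-≤ p (subst (_≤ a) (sym (+-suc i b)) i+b<a) ⟩
      p ^ a                <⟨ p^a<p^[2+b]*N ⟩
      p * p ^ suc b * N    ≡⟨ swap p (p ^ suc b) N ⟩
      p * N * p ^ suc b    ∎)
    where
    open ≤-Reasoning
    swap : ∀ x y z → x * y * z ≡ x * z * y
    swap = solve-∀

  N-dense : Dense p N
  N-dense = Dense-*-product (Dense-p^ p b) (tabulate⁺ bounds)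
    where
    bounds : ∀ j → 1 ≤ q (F.suc j) × q (F.suc j) ≤ p ^ b
    bounds j = ≤-<-trans z≤n (p<q (F.suc j)) , <⇒≤ (≤-<-trans (q≤qₖ (F.suc j)) qₖ<p^b)

  p^a≡p^[a∸i]*p^i : ∀ {i} → i ≤ a → p ^ a ≡ p ^ (a ∸ i) * p ^ i
  p^a≡p^[a∸i]*p^i {i} i≤a = trans (cong (p ^_) (sym (m∸n+n≡m i≤a))) (^-distribˡ-+-* p (a ∸ i) i)

  record Image (i : ℕ) : Set where
    constructor image
    field
      value quot    : ℕ
      m≡quot*value  : m ≡ quot * value
      value≤p^i     : value ≤ p ^ i
      quot≤p^[a∸i]  : quot ≤ p ^ (a ∸ i)
      shape         : (p ^ i < p * value × q₀ ∣ quot) ⊎ quot ≡ p ^ (a ∸ i)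
  open Image

  quot-bound : ∀ {i c t} → i ≤ a → m ≡ c * t → p ^ i < p * t → c ≤ p ^ (a ∸ i)
  quot-bound {i} {c} {t} i≤a m≡c*t p^i<pt =
    <⇒≤ (*-cancelʳ-< t c _ (*-cancelʳ-< p _ _ (begin-strict
      c * t * p                  ≡⟨ cong (_* p) m≡c*t ⟨
      m * p                      <⟨ m*p<p^a ⟩
      p ^ a                      ≡⟨ p^a≡p^[a∸i]*p^i i≤a ⟩
      p ^ (a ∸ i) * p ^ i        <⟨ *-monoʳ-< (p ^ (a ∸ i)) {{m^n≢0 p (a ∸ i)}} p^i<pt ⟩
      p ^ (a ∸ i) * (p * t)      ≡⟨ swap (p ^ (a ∸ i)) p t ⟩
      p ^ (a ∸ i) * t * p        ∎)))
    where
    open ≤-Reasoning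
    swap : ∀ x y z → x * (y * z) ≡ x * z * y
    swap = solve-∀

  image-of : ∀ i → i ≤ a → Image i
  image-of i i≤a with i + b <? a
  ... | yes i+b<a = fromDivisor (N-dense (p ^ i) (m^n>0 p i) (p^i<p*N i+b<a))
    where
    fromDivisor : ∃[ t ] t ∣ N × t ≤ p ^ i × p ^ i < p * t → Image i
    fromDivisor (t , divides e N≡e*t , t≤p^i , p^i<pt) =
      image t (q₀ * e) m≡q₀e*t t≤p^i (quot-bound i≤a m≡q₀e*t p^i<pt) (inj₁ (p^i<pt , m∣m*n e))
      where
      m≡q₀e*t : m ≡ q₀ * e * t
      m≡q₀e*t = trans m≡q₀*N (trans (cong (q₀ *_) N≡e*t) (sym (*-assoc q₀ e t)))
  ... | no i+b≮a = image t (p ^ (a ∸ i)) m≡p^[a∸i]*t t≤p^i ≤-refl (inj₂ refl)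
    where
    a∸i≤b : a ∸ i ≤ b
    a∸i≤b = m≤n+o⇒m∸n≤o a i (≮⇒≥ i+b≮a)
    t : ℕ
    t = p ^ (b ∸ (a ∸ i)) * Q * qₖ
    m≡p^[a∸i]*t : m ≡ p ^ (a ∸ i) * t
    m≡p^[a∸i]*t = begin
      p ^ b * Q * qₖ                                ≡⟨ cong (λ e → p ^ e * Q * qₖ) (m+[n∸m]≡n a∸i≤b) ⟨
      p ^ (a ∸ i + (b ∸ (a ∸ i))) * Q * qₖ          ≡⟨ cong (λ e → e * Q * qₖ) (^-distribˡ-+-* p (a ∸ i) _) ⟩
      p ^ (a ∸ i) * p ^ (b ∸ (a ∸ i)) * Q * qₖ      ≡⟨ regroup (p ^ (a ∸ i)) (p ^ (b ∸ (a ∸ i))) Q qₖ ⟩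
      p ^ (a ∸ i) * t                               ∎
      where
      open ≡-Reasoning
      regroup : ∀ x y z w → x * y * z * w ≡ x * (y * z * w)
      regroup = solve-∀
    t≤p^i : t ≤ p ^ i
    t≤p^i = *-cancelˡ-≤ (p ^ (a ∸ i)) {{m^n≢0 p (a ∸ i)}}
              (subst₂ _≤_ m≡p^[a∸i]*t (p^a≡p^[a∸i]*p^i i≤a) (≤-trans (m≤m*n m p) (<⇒≤ m*p<p^a)))

  value≢0 : ∀ {i} (s : Image i) → NonZero (value s)
  value≢0 s = m*n≢0⇒n≢0 (quot s) {{subst NonZero (m≡quot*value s) m≢0}}

  value∣m : ∀ {i} (s : Image i) → value s ∣ m
  value∣m s = divides (quot s) (m≡quot*value s)

  quot∣m : ∀ {i} (s : Image i) → quot s ∣ m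
  quot∣m s = divides (value s) (trans (m≡quot*value s) (*-comm (quot s) (value s)))

  value-odd : p ≢ 2 → ∀ {i} (s : Image i) → ¬ 2 ∣ value s
  value-odd p≢2 s 2∣value = p≢2 (≤-antisym (m-rough 2 prime[2] (∣-trans 2∣value (value∣m s))) (prime>1 p-prime))

  q₀∤p^ : ∀ n → ¬ q₀ ∣ p ^ n
  q₀∤p^ n q₀∣p^n = <⇒≢ p<q₀ (sym (prime∣prime^⇒≡ (q-prime zero) p-prime n q₀∣p^n))

  ^-sandwich : ∀ {t i j} → t ≤ p ^ i → p ^ j < p * t → j ≤ i
  ^-sandwich t≤p^i p^j<pt = s≤s⁻¹ (^-cancelʳ-< p (<-≤-trans p^j<pt (*-monoʳ-≤ p t≤p^i)))

  quot-unique : ∀ {i j} (s : Image i) (s' : Image j) → value s ≡ value s' → quot s ≡ quot s'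
  quot-unique s s' v≡v' = *-cancelʳ-≡ (quot s) (quot s') (value s) {{value≢0 s}}
    (trans (sym (m≡quot*value s)) (trans (m≡quot*value s') (cong (quot s' *_) (sym v≡v'))))

  value-injective : ∀ {i j} → i ≤ a → j ≤ a → (s : Image i) (s' : Image j) → value s ≡ value s' → i ≡ j
  value-injective _ _ (image t _ _ t≤p^i _ (inj₁ (p^i<pt , _))) (image t _ _ t≤p^j _ (inj₁ (p^j<pt , _))) refl =
    ≤-antisym (^-sandwich t≤p^j p^i<pt) (^-sandwich t≤p^i p^j<pt)
  value-injective {j = j} _ _ s@(image _ _ _ _ _ (inj₁ (_ , q₀∣c))) s'@(image _ _ _ _ _ (inj₂ c'≡p^[a∸j])) v≡v' =
    ⊥-elim (q₀∤p^ (a ∸ j) (subst (q₀ ∣_) (trans (quot-unique s s' v≡v') c'≡p^[a∸j]) q₀∣c))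
  value-injective {i} _ _ s@(image _ _ _ _ _ (inj₂ c≡p^[a∸i])) s'@(image _ _ _ _ _ (inj₁ (_ , q₀∣c'))) v≡v' =
    ⊥-elim (q₀∤p^ (a ∸ i) (subst (q₀ ∣_) (trans (quot-unique s' s (sym v≡v')) c≡p^[a∸i]) q₀∣c'))
  value-injective i≤a j≤a s@(image _ _ _ _ _ (inj₂ refl)) s'@(image _ _ _ _ _ (inj₂ refl)) v≡v' =
    ∸-cancelˡ-≡ i≤a j≤a (^-injectiveʳ (prime>1 p-prime) (quot-unique s s' v≡v'))

  exponent : ∀ {d} → d ∣ p ^ a → ∃[ i ] i ≤ a × d ≡ p ^ i
  exponent = ∣prime^⇒≡prime^ p-prime a

  f : 𝒟 (p ^ a) → 𝒟 m
  f (_ , d∣p^a) = value s , value∣m s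
    where
    s : Image (proj₁ (exponent d∣p^a))
    s = image-of (proj₁ (exponent d∣p^a)) (proj₁ (proj₂ (exponent d∣p^a)))

  f-≤ : ∀ d → proj₁ (f d) ≤ proj₁ d
  f-≤ (_ , d∣p^a) with exponent d∣p^a
  ... | i , i≤a , refl = value≤p^i (image-of i i≤a)

  f-cofactor : ∀ d ℓA ℓB → LPF (cofactor (f d)) ℓA → LPF (cofactor d) ℓB →
               cofactor (f d) ≤ cofactor d × cofactor (f d) * ℓB ≤ ℓA * cofactor d
  f-cofactor (_ , d∣p^a@(divides B p^a≡B*d)) ℓA ℓB lpfA lpfB with exponent d∣p^a
  ... | i , i≤a , refl = quot≤B , LPF-cross-≤ {n = a} p-prime quot-rough B∣p^a 0<B quot≤B lpfA lpfB
    where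
    s : Image i
    s = image-of i i≤a
    B≡p^[a∸i] : B ≡ p ^ (a ∸ i)
    B≡p^[a∸i] = *-cancelʳ-≡ B _ (p ^ i) {{m^n≢0 p i}} (trans (sym p^a≡B*d) (p^a≡p^[a∸i]*p^i i≤a))
    0<B : 0 < B
    0<B = subst (0 <_) (sym B≡p^[a∸i]) (m^n>0 p (a ∸ i))
    quot≤B : quot s ≤ B
    quot≤B = subst (quot s ≤_) (sym B≡p^[a∸i]) (quot≤p^[a∸i] s)
    B∣p^a : B ∣ p ^ a
    B∣p^a = divides (p ^ i) (trans p^a≡B*d (*-comm B (p ^ i)))
    quot-rough : ∀ ℓ → Prime ℓ → ℓ ∣ quot s → p ≤ ℓ
    quot-rough ℓ ℓ-prime ℓ∣quot = m-rough ℓ ℓ-prime (∣-trans ℓ∣quot (quot∣m s))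

  f-Pow2Related : ∀ d d' → Pow2Related (proj₁ (f d)) (proj₁ (f d')) → Pow2Related (proj₁ d) (proj₁ d')
  f-Pow2Related (_ , d∣p^a) (_ , d'∣p^a) related with exponent d∣p^a | exponent d'∣p^a
  ... | i , i≤a , refl | j , j≤a , refl with p ≟ 2
  ...   | yes refl = Pow2Related-2^ i j
  ...   | no p≢2   = 0 , 0 , cong (λ e → p ^ e * 1) i≡j
    where
    s : Image i
    s = image-of i i≤a
    s' : Image j
    s' = image-of j j≤a
    i≡j : i ≡ j
    i≡j = value-injective i≤a j≤a s s' (odd-Pow2Related⇒≡ (value-odd p≢2 s) (value-odd p≢2 s') related)

  reduces : Reduces (p ^ a) m
  reduces = f , f-≤ , f-cofactor , f-Pow2Related

lemma3p9 : (p k a b : ℕ) (q : Fin (suc k) → ℕ) →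
    Prime p → (∀ i → Prime (q i)) →
    p < q zero → (∀ i j → i F.< j → q i < q j) →
    initProd q * lastQ q * lastQ q * p ^ 2 < p ^ a →
    p ^ (2 * b) * initProd q ≤ p ^ a →
    p ^ a < p ^ (2 * b + 2) * initProd q →
    Reduces (p ^ a) (p ^ b * initProd q * lastQ q)
lemma3p9 = Reduction.reduces
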